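{- Let $F$ be a field of characteristic $p\neq 3$, let $a\in F$ be such that $X^3-3X-a$ is irreducible over $F$, and let $y_1,y_2$ be two distinct roots of $X^3-3X-a$ in an algebraic closure $\overline{F}$. Then $$y_1=-\frac{1+2f}{a}y_2^2+fy_2+\frac{2(1+2f)}{a},$$ where $f\in\overline{F}$ is a root of the polynomial $X^2+X+\frac{a^2-1}{a^2-4}$. -}

module Defs where

open import Level using (Level; _⊔_) renaming (suc to lsuc)
open import Data.Nat using (ℕ; zero; suc; _<_; _≤_; _∸_; s≤s; z≤n)
open import Data.Product using (Σ; ∃; _×_; _,_)
open import Data.Sum using (_⊎_)
open import Relation.Nullary using (¬_)
open import Algebra.Bundles using (CommutativeRing)
open import Algebra.Morphism.Structures using (module RingMorphisms)

private
  variable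
    c ℓ c′ ℓ′ : Level

-- The inverse is a total
-- operation (its value at 0 is unspecified), respecting ≈.

record Field (c ℓ : Level) : Set (lsuc (c ⊔ ℓ)) where
  field
    commutativeRing : CommutativeRing c ℓ
  open CommutativeRing commutativeRing public
  field
    _⁻¹         : Carrier → Carrier
    ⁻¹-cong     : ∀ {x y} → x ≈ y → x ⁻¹ ≈ y ⁻¹
    1≉0         : ¬ (1# ≈ 0#)
    ⁻¹-inverseʳ : ∀ x → ¬ (x ≈ 0#) → x * x ⁻¹ ≈ 1#

  infixl 7 _/_
  _/_ : Carrier → Carrier → Carrier
  x / y = x * y ⁻¹

  _^_ : Carrier → ℕ → Carrier
  x ^ zero  = 1#
  x ^ suc n = x * (x ^ n)

  3# : Carrier
  3# = 1# + 1# + 1#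

  2# : Carrier
  2# = 1# + 1#

IsFieldHom : (F : Field c ℓ) (K : Field c′ ℓ′) →
             (Field.Carrier F → Field.Carrier K) → Set _
IsFieldHom F K ι =
  RingMorphisms.IsRingHomomorphism (Field.rawRing F) (Field.rawRing K) ι

-- Polynomials over a commutative ring, as finitely supported
-- coefficient sequences (coefficient k is the coefficient of X^k).

module _ (R : CommutativeRing c ℓ) where
  open CommutativeRing R

  record Poly : Set (c ⊔ ℓ) where
    field
      coeff  : ℕ → Carrier
      bound  : ℕ
      vanish : ∀ k → bound < k → coeff k ≈ 0#
  open Poly public

  sumTo : (ℕ → Carrier) → ℕ → Carrier
  sumTo f zero    = f 0
  sumTo f (suc n) = sumTo f n + f (suc n)

  mulCoeff : Poly → Poly → ℕ → Carrier
  mulCoeff g h k = sumTo (λ i → coeff g i * coeff h (k ∸ i)) k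

  oneCoeff : ℕ → Carrier
  oneCoeff zero    = 1#
  oneCoeff (suc _) = 0#

  IsZeroPoly : Poly → Set ℓ
  IsZeroPoly p = ∀ k → coeff p k ≈ 0#

  IsUnitPoly : Poly → Set (c ⊔ ℓ)
  IsUnitPoly p = Σ Poly λ u → ∀ k → mulCoeff p u k ≈ oneCoeff k

  Irreducible : Poly → Set (c ⊔ ℓ)
  Irreducible p =
    ¬ IsZeroPoly p × ¬ IsUnitPoly p ×
    (∀ g h → (∀ k → coeff p k ≈ mulCoeff g h k) → IsUnitPoly g ⊎ IsUnitPoly h)

  Nonconstant : Poly → Set ℓ
  Nonconstant p = ∃ λ k → 1 ≤ k × ¬ (coeff p k ≈ 0#)

module _ (F : Field c ℓ) (K : Field c′ ℓ′) where
  private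
    module F = Field F
    module K = Field K

  evalVia : (Field.Carrier F → Field.Carrier K) →
            Poly F.commutativeRing → K.Carrier → K.Carrier
  evalVia ι p x = sumTo K.commutativeRing (λ k → ι (coeff p k) K.* (x K.^ k))
                        (bound p)

EvalK : (K : Field c ℓ) → Poly (Field.commutativeRing K) → Field.Carrier K → Field.Carrier K
EvalK K p x = evalVia K K (λ z → z) p x

IsAlgebraicallyClosed : Field c ℓ → Set _
IsAlgebraicallyClosed K =
  ∀ (p : Poly (Field.commutativeRing K)) → Nonconstant (Field.commutativeRing K) p →
    ∃ λ x → Field._≈_ K (EvalK K p x) (Field.0# K)

record IsAlgebraicClosure (F : Field c ℓ) (K : Field c′ ℓ′)
                          (ι : Field.Carrier F → Field.Carrier K) : Set (c ⊔ ℓ ⊔ c′ ⊔ ℓ′) where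
  field
    hom        : IsFieldHom F K ι
    algClosed  : IsAlgebraicallyClosed K
    algebraic  : ∀ x → Σ (Poly (Field.commutativeRing F)) λ p →
                   ¬ IsZeroPoly (Field.commutativeRing F) p ×
                   Field._≈_ K (evalVia F K ι p x) (Field.0# K)

module _ (F : Field c ℓ) where
  open Field F

  cubicCoeff : Carrier → ℕ → Carrier
  cubicCoeff a 0 = - a
  cubicCoeff a 1 = - 3#
  cubicCoeff a 2 = 0#
  cubicCoeff a 3 = 1#
  cubicCoeff a (suc (suc (suc (suc _)))) = 0#

  private
    cubicVanish : ∀ a k → 3 < k → cubicCoeff a k ≈ 0#
    cubicVanish a (suc (suc (suc (suc k)))) _ = refl
    cubicVanish a 0 ()
    cubicVanish a 1 (s≤s ())
    cubicVanish a 2 (s≤s (s≤s ()))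
    cubicVanish a 3 (s≤s (s≤s (s≤s ())))

  cubic : Carrier → Poly commutativeRing
  cubic a = record { coeff = cubicCoeff a ; bound = 3 ; vanish = cubicVanish a }

-- Irreducibility of X³ − 3X − a is used only to exclude roots in F: a root r would split off the
-- monic factor X − r, and monic polynomials of positive degree are not units.  Excluding the roots
-- 0, −1 and 1 gives a ≠ 0 and a² ≠ 4.  For distinct roots y, z in K the difference of the two cubic
-- relations gives z² + zy + y² = 3.  With D = a y − 2y² + 4, N = a z + y² − 2 and f = N / D, every
-- claim is then a polynomial identity modulo these two relations:
--   a² − 4 = (y² − 1) D + (2y − a)(y³ − 3y − a)            so D ≠ 0,
--   (a² − 4)(N² + N D) + (a² − 1) D² ≡ 0                   so f² + f + (a² − 1)/(a² − 4) = 0,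
--   D + 2N = a (y + 2z),  (y + 2z)(2 − y²) + N y = z D     which give the formula for z.

module Submission where

open import Defs
open import Level using (Level)
open import Data.Product using (∃; _×_)
open import Relation.Nullary using (¬_)

open import Algebra.Bundles using (CommutativeRing)
open import Algebra.Morphism.Structures using (module RingMorphisms)
open import Algebra.Solver.Ring.AlmostCommutativeRing
  using (fromCommutativeRing; _-Raw-AlmostCommutative⟶_)
open import Data.Integer.Base as ℤ using (ℤ; +_; -[1+_]; _⊖_; _◃_; sign; ∣_∣)
import Data.Integer.Properties as ℤ
open import Data.Maybe.Base using (Maybe; just; nothing)
open import Data.Nat.Base as ℕ using (ℕ; zero; suc; _≤_; _<_; z≤n; s≤s)
import Data.Nat.Properties as ℕₚ
open ℕₚ using ( ≤-trans; <-cmp; <⇒≤; <⇒≢; +-monoʳ-≤; +-monoˡ-<; +-∸-comm; m<n⇒0<n∸m; m+n∸m≡n; m≤m+n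
              ; m≤n⇒m≤1+n; m≤n⇒m<n∨m≡n)
open import Data.Empty using (⊥-elim)
open import Data.Product using (_,_; proj₂)
open import Data.Sign.Base as Sign using (Sign)
open import Data.Sum using (inj₁; inj₂; [_,_]′)
open import Relation.Binary.Definitions using (tri<; tri≈; tri>)
open import Relation.Binary.PropositionalEquality.Core as ≡ using (_≢_)
open import Relation.Nullary.Decidable.Core using (yes; no)

-- The reflective solver of the standard library takes coefficients in the ring itself and so cannot
-- identify numeral coefficients such as (1 + 1)(1 + 1) and 1 + 1 + 1 + 1 in an abstract ring.
module IntegerRingSolver {c ℓ} (R : CommutativeRing c ℓ) where

  open CommutativeRing R
  open import Algebra.Properties.Ring ring
  import Algebra.Properties.CommutativeSemigroup as CommutativeSemigroupProperties
  open CommutativeSemigroupProperties *-commutativeSemigroup using () renaming (interchange to *-interchange)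
  open CommutativeSemigroupProperties +-commutativeSemigroup using () renaming (interchange to +-interchange)
  open import Algebra.Properties.Semiring.Mult.TCOptimised semiring renaming (_×_ to _×′_)
  open import Relation.Binary.Reasoning.Setoid setoid

  -- With the tail-recursive multiple _×′_, ⟦ + 2 ⟧ℤ and ⟦ + 3 ⟧ℤ reduce to the numerals 2# and 3# of Field.
  ⟦_⟧ℤ : ℤ → Carrier
  ⟦ + n ⟧ℤ      = n ×′ 1#
  ⟦ -[1+ n ] ⟧ℤ = - (suc n ×′ 1#)

  ⟦-+⟧ : ∀ n → ⟦ ℤ.- + n ⟧ℤ ≈ - (n ×′ 1#)
  ⟦-+⟧ zero    = sym -0#≈0#
  ⟦-+⟧ (suc n) = refl

  x+y-[x+z]≈y-z : ∀ x y z → (x + y) - (x + z) ≈ y - z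
  x+y-[x+z]≈y-z x y z = begin
    (x + y) - (x + z)      ≈⟨ +-congˡ (-‿+-comm x z) ⟨
    (x + y) + (- x + - z)  ≈⟨ +-interchange x y (- x) (- z) ⟩
    (x - x) + (y - z)      ≈⟨ +-congʳ (-‿inverseʳ x) ⟩
    0# + (y - z)           ≈⟨ +-identityˡ (y - z) ⟩
    y - z                  ∎

  ⟦⊖⟧ : ∀ m n → ⟦ m ⊖ n ⟧ℤ ≈ m ×′ 1# - n ×′ 1#
  ⟦⊖⟧ m       zero    = sym (trans (+-congˡ -0#≈0#) (+-identityʳ _))
  ⟦⊖⟧ zero    (suc n) = sym (+-identityˡ _)
  ⟦⊖⟧ (suc m) (suc n) = begin
    ⟦ suc m ⊖ suc n ⟧ℤ                ≡⟨ ≡.cong ⟦_⟧ℤ (ℤ.[1+m]⊖[1+n]≡m⊖n m n) ⟩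
    ⟦ m ⊖ n ⟧ℤ                        ≈⟨ ⟦⊖⟧ m n ⟩
    m ×′ 1# - n ×′ 1#                 ≈⟨ x+y-[x+z]≈y-z 1# _ _ ⟨
    (1# + m ×′ 1#) - (1# + n ×′ 1#)   ≈⟨ +-cong (1+× m 1#) (-‿cong (1+× n 1#)) ⟨
    suc m ×′ 1# - suc n ×′ 1#         ∎

  ⟦+⟧ : ∀ i j → ⟦ i ℤ.+ j ⟧ℤ ≈ ⟦ i ⟧ℤ + ⟦ j ⟧ℤ
  ⟦+⟧ (+ m)      (+ n)      = ×-homo-+ 1# m n
  ⟦+⟧ (+ m)      -[1+ n ]   = ⟦⊖⟧ m (suc n)
  ⟦+⟧ -[1+ m ]   (+ n)      = trans (⟦⊖⟧ n (suc m)) (+-comm _ _)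
  ⟦+⟧ -[1+ m ]   -[1+ n ]   = begin
    - (suc (suc (m ℕ.+ n)) ×′ 1#)      ≡⟨ ≡.cong (λ k → - (suc k ×′ 1#)) (ℕₚ.+-suc m n) ⟨
    - ((suc m ℕ.+ suc n) ×′ 1#)        ≈⟨ -‿cong (×-homo-+ 1# (suc m) (suc n)) ⟩
    - (suc m ×′ 1# + suc n ×′ 1#)      ≈⟨ -‿+-comm _ _ ⟨
    - (suc m ×′ 1#) + - (suc n ×′ 1#)  ∎

  ⟦-⟧ : ∀ i → ⟦ ℤ.- i ⟧ℤ ≈ - ⟦ i ⟧ℤ
  ⟦-⟧ (+ n)      = ⟦-+⟧ n
  ⟦-⟧ -[1+ n ]   = sym (-‿involutive _)

  ⟦_⟧ₛ : Sign → Carrier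
  ⟦ s ⟧ₛ = ⟦ s ◃ 1 ⟧ℤ

  ⟦◃⟧ : ∀ s n → ⟦ s ◃ n ⟧ℤ ≈ ⟦ s ⟧ₛ * (n ×′ 1#)
  ⟦◃⟧ Sign.+ n = begin
    ⟦ Sign.+ ◃ n ⟧ℤ  ≡⟨ ≡.cong ⟦_⟧ℤ (ℤ.+◃n≡+n n) ⟩
    n ×′ 1#          ≈⟨ *-identityˡ _ ⟨
    1# * (n ×′ 1#)   ∎
  ⟦◃⟧ Sign.- n = begin
    ⟦ Sign.- ◃ n ⟧ℤ   ≡⟨ ≡.cong ⟦_⟧ℤ (ℤ.-◃n≡-n n) ⟩
    ⟦ ℤ.- + n ⟧ℤ      ≈⟨ ⟦-+⟧ n ⟩
    - (n ×′ 1#)       ≈⟨ -1*x≈-x _ ⟨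
    - 1# * (n ×′ 1#)  ∎

  ⟦sign◃∣∣⟧ : ∀ i → ⟦ i ⟧ℤ ≈ ⟦ sign i ⟧ₛ * (∣ i ∣ ×′ 1#)
  ⟦sign◃∣∣⟧ i = trans (reflexive (≡.cong ⟦_⟧ℤ (≡.sym (ℤ.◃-inverse i)))) (⟦◃⟧ (sign i) ∣ i ∣)

  ⟦*⟧ₛ : ∀ s t → ⟦ s Sign.* t ⟧ₛ ≈ ⟦ s ⟧ₛ * ⟦ t ⟧ₛ
  ⟦*⟧ₛ Sign.+ t      = sym (*-identityˡ _)
  ⟦*⟧ₛ Sign.- Sign.+ = sym (*-identityʳ _)
  ⟦*⟧ₛ Sign.- Sign.- = begin
    1#             ≈⟨ -‿involutive 1# ⟨
    - - 1#         ≈⟨ -1*x≈-x (- 1#) ⟨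
    - 1# * - 1#    ∎

  ⟦*⟧ : ∀ i j → ⟦ i ℤ.* j ⟧ℤ ≈ ⟦ i ⟧ℤ * ⟦ j ⟧ℤ
  ⟦*⟧ i j = begin
    ⟦ (sign i Sign.* sign j) ◃ (∣ i ∣ ℕ.* ∣ j ∣) ⟧ℤ
      ≈⟨ ⟦◃⟧ (sign i Sign.* sign j) (∣ i ∣ ℕ.* ∣ j ∣) ⟩
    ⟦ sign i Sign.* sign j ⟧ₛ * ((∣ i ∣ ℕ.* ∣ j ∣) ×′ 1#)
      ≈⟨ *-cong (⟦*⟧ₛ (sign i) (sign j)) (×1-homo-* ∣ i ∣ ∣ j ∣) ⟩
    (⟦ sign i ⟧ₛ * ⟦ sign j ⟧ₛ) * ((∣ i ∣ ×′ 1#) * (∣ j ∣ ×′ 1#))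
      ≈⟨ *-interchange _ _ _ _ ⟩
    (⟦ sign i ⟧ₛ * (∣ i ∣ ×′ 1#)) * (⟦ sign j ⟧ₛ * (∣ j ∣ ×′ 1#))
      ≈⟨ *-cong (⟦sign◃∣∣⟧ i) (⟦sign◃∣∣⟧ j) ⟨
    ⟦ i ⟧ℤ * ⟦ j ⟧ℤ
      ∎

  ℤ⟶R : CommutativeRing.rawRing ℤ.+-*-commutativeRing -Raw-AlmostCommutative⟶ fromCommutativeRing R
  ℤ⟶R = record
    { ⟦_⟧    = ⟦_⟧ℤ
    ; +-homo = ⟦+⟧
    ; *-homo = ⟦*⟧
    ; -‿homo = ⟦-⟧
    ; 0-homo = refl
    ; 1-homo = refl
    }

  ⟦⟧-weaklyDec : ∀ i j → Maybe (⟦ i ⟧ℤ ≈ ⟦ j ⟧ℤ)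
  ⟦⟧-weaklyDec i j with i ℤ.≟ j
  ... | yes ≡.refl = just refl
  ... | no _       = nothing

  open import Algebra.Solver.Ring _ _ ℤ⟶R ⟦⟧-weaklyDec public

module CubicIdentities {c ℓ} (R : CommutativeRing c ℓ) where

  open CommutativeRing R
  open IntegerRingSolver R using (solve; _:=_; _:+_; _:*_; _:-_; con)

  2# 3# : Carrier
  2# = 1# + 1#
  3# = 2# + 1#

  cubicValue : Carrier → Carrier → Carrier
  cubicValue A y = y * y * y - 3# * y - A

  numerator : Carrier → Carrier → Carrier → Carrier
  numerator A y z = A * z + y * y - 2#

  denominator : Carrier → Carrier → Carrier
  denominator A y = A * y - 2# * (y * y) + (2# + 2#)

  cubicValue-difference : ∀ A y z →
    cubicValue A z - cubicValue A y ≈ (z - y) * (z * z + z * y + y * y - 3#)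
  cubicValue-difference = solve 3 (λ A y z →
    (z :* z :* z :- con (+ 3) :* z :- A) :- (y :* y :* y :- con (+ 3) :* y :- A)
    := (z :- y) :* (z :* z :+ z :* y :+ y :* y :- con (+ 3))) refl

  denominator-certificate : ∀ A y →
    A * A - (2# + 2#) ≈ (y * y - 1#) * denominator A y + (2# * y - A) * cubicValue A y
  denominator-certificate = solve 2 (λ A y →
    A :* A :- (con (+ 2) :+ con (+ 2))
    := (y :* y :- con (+ 1)) :* (A :* y :- con (+ 2) :* (y :* y) :+ (con (+ 2) :+ con (+ 2)))
       :+ (con (+ 2) :* y :- A) :* (y :* y :* y :- con (+ 3) :* y :- A)) refl

  f-quadratic-certificate : ∀ A y z →
    let N = numerator A y z ; D = denominator A y in
    (A * A - (2# + 2#)) * (N * N + N * D) + (A * A - 1#) * (D * D)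
      ≈ (A * A) * ((A * A - (2# + 2#)) * (z * z + z * y + y * y - 3#) + 3# * (y - A) * cubicValue A y)
  f-quadratic-certificate = solve 3 (λ A y z →
    let N = A :* z :+ y :* y :- con (+ 2)
        D = A :* y :- con (+ 2) :* (y :* y) :+ (con (+ 2) :+ con (+ 2))
    in (A :* A :- (con (+ 2) :+ con (+ 2))) :* (N :* N :+ N :* D) :+ (A :* A :- con (+ 1)) :* (D :* D)
       := (A :* A) :* ((A :* A :- (con (+ 2) :+ con (+ 2))) :* (z :* z :+ z :* y :+ y :* y :- con (+ 3))
                       :+ con (+ 3) :* (y :- A) :* (y :* y :* y :- con (+ 3) :* y :- A))) refl

  denominator+2*numerator : ∀ A y z →
    denominator A y + 2# * numerator A y z ≈ A * (y + 2# * z)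
  denominator+2*numerator = solve 3 (λ A y z →
    (A :* y :- con (+ 2) :* (y :* y) :+ (con (+ 2) :+ con (+ 2))) :+ con (+ 2) :* (A :* z :+ y :* y :- con (+ 2))
    := A :* (y :+ con (+ 2) :* z)) refl

  z-formula-certificate : ∀ A y z →
    (y + 2# * z) * (2# - y * y) + numerator A y z * y ≈ z * denominator A y
  z-formula-certificate = solve 3 (λ A y z →
    (y :+ con (+ 2) :* z) :* (con (+ 2) :- y :* y) :+ (A :* z :+ y :* y :- con (+ 2)) :* y
    := z :* (A :* y :- con (+ 2) :* (y :* y) :+ (con (+ 2) :+ con (+ 2)))) refl

downwards-induction : ∀ {p} (P : ℕ → Set p) (b : ℕ) →
                      (∀ j → b < j → P j) →
                      (∀ j → (∀ k → j < k → P k) → P j) →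
                      ∀ j → P j
downwards-induction P b above step j = go (suc b) j (s≤s (m≤m+n b j))
  where
    go : ∀ t j → b < t ℕ.+ j → P j
    go zero    j b<j     = above j b<j
    go (suc t) j b<1+t+j = step j λ k j<k →
      go t k (≤-trans b<1+t+j (≡.subst (_≤ t ℕ.+ k) (ℕₚ.+-suc t j) (+-monoʳ-≤ t j<k)))

module PolynomialProperties {c ℓ} (R : CommutativeRing c ℓ) where

  open CommutativeRing R
  open import Relation.Binary.Reasoning.Setoid setoid

  sumTo-zero : ∀ (f : ℕ → Carrier) n → (∀ i → i ≤ n → f i ≈ 0#) → sumTo R f n ≈ 0#
  sumTo-zero f zero    f≈0 = f≈0 0 z≤n
  sumTo-zero f (suc n) f≈0 = begin
    sumTo R f n + f (suc n) ≈⟨ +-cong (sumTo-zero f n λ i i≤n → f≈0 i (m≤n⇒m≤1+n i≤n))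
                                      (f≈0 (suc n) ℕₚ.≤-refl) ⟩
    0# + 0#                 ≈⟨ +-identityʳ 0# ⟩
    0#                      ∎

  sumTo-point : ∀ (f : ℕ → Carrier) {m} n → m ≤ n → (∀ i → i ≢ m → f i ≈ 0#) → sumTo R f n ≈ f m
  sumTo-point f zero    z≤n f≈0 = refl
  sumTo-point f {m} (suc n) m≤1+n f≈0 with m≤n⇒m<n∨m≡n m≤1+n
  ... | inj₁ (s≤s m≤n) = begin
    sumTo R f n + f (suc n) ≈⟨ +-cong (sumTo-point f n m≤n f≈0)
                                      (f≈0 (suc n) (≡.≢-sym (<⇒≢ (s≤s m≤n)))) ⟩
    f m + 0#                ≈⟨ +-identityʳ (f m) ⟩
    f m                     ∎
  ... | inj₂ ≡.refl = begin
    sumTo R f n + f (suc n) ≈⟨ +-congʳ (sumTo-zero f n λ i i≤n → f≈0 i (<⇒≢ (s≤s i≤n))) ⟩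
    0# + f (suc n)          ≈⟨ +-identityˡ (f (suc n)) ⟩
    f (suc n)               ∎

  linearCoeff : Carrier → ℕ → Carrier
  linearCoeff c 0             = c
  linearCoeff c 1             = 1#
  linearCoeff c (suc (suc _)) = 0#

  linear : Carrier → Poly R
  linear c = record
    { coeff  = linearCoeff c
    ; bound  = 1
    ; vanish = λ { 1 (s≤s ()) ; (suc (suc k)) _ → refl }
    }

  quadraticCoeff : Carrier → Carrier → ℕ → Carrier
  quadraticCoeff b c 0                   = c
  quadraticCoeff b c 1                   = b
  quadraticCoeff b c 2                   = 1#
  quadraticCoeff b c (suc (suc (suc _))) = 0#

  quadratic : Carrier → Carrier → Poly R
  quadratic b c = record
    { coeff  = quadraticCoeff b c
    ; bound  = 2
    ; vanish = λ { 1 (s≤s ()) ; 2 (s≤s (s≤s ())) ; (suc (suc (suc k))) _ → refl }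
    }

  -- If p u = 1 and all coefficients of u above j vanish, the coefficient of X^(d + j) in p u is u_j;
  -- downward induction then gives u = 0.
  monic⇒¬unit : ¬ 1# ≈ 0# → ∀ p m → (∀ k → suc m < k → coeff p k ≈ 0#) → coeff p (suc m) ≈ 1# →
                ¬ IsUnitPoly R p
  monic⇒¬unit 1≉0 p m above lead (u , pu≈1) = 1≉0 (begin
    1#                    ≈⟨ pu≈1 0 ⟨
    coeff p 0 * coeff u 0 ≈⟨ *-congˡ (u≈0 0) ⟩
    coeff p 0 * 0#        ≈⟨ zeroʳ (coeff p 0) ⟩
    0#                    ∎)
    where
      d = suc m

      j<d+j∸i : ∀ {i} j → i < d → j < d ℕ.+ j ℕ.∸ i
      j<d+j∸i j i<d = ≡.subst (j <_) (≡.sym (+-∸-comm j (<⇒≤ i<d))) (+-monoˡ-< j (m<n⇒0<n∸m i<d))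

      higher≈0⇒≈0 : ∀ j → (∀ k → j < k → coeff u k ≈ 0#) → coeff u j ≈ 0#
      higher≈0⇒≈0 j higher≈0 = begin
        coeff u j                           ≈⟨ *-identityˡ (coeff u j) ⟨
        1# * coeff u j                      ≈⟨ *-congʳ lead ⟨
        coeff p d * coeff u j               ≡⟨ ≡.cong (λ k → coeff p d * coeff u k) (m+n∸m≡n d j) ⟨
        coeff p d * coeff u (d ℕ.+ j ℕ.∸ d) ≈⟨ sumTo-point _ (d ℕ.+ j) (m≤m+n d j) off-leading ⟨
        mulCoeff R p u (d ℕ.+ j)            ≈⟨ pu≈1 (d ℕ.+ j) ⟩
        0#                                  ∎
        where
          off-leading : ∀ i → i ≢ d → coeff p i * coeff u (d ℕ.+ j ℕ.∸ i) ≈ 0#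
          off-leading i i≢d with <-cmp i d
          ... | tri< i<d _ _ = trans (*-congˡ (higher≈0 _ (j<d+j∸i j i<d))) (zeroʳ _)
          ... | tri≈ _ i≡d _ = ⊥-elim (i≢d i≡d)
          ... | tri> _ _ d<i = trans (*-congʳ (above i d<i)) (zeroˡ _)

      u≈0 : ∀ j → coeff u j ≈ 0#
      u≈0 = downwards-induction (λ j → coeff u j ≈ 0#) (bound u) (vanish u) higher≈0⇒≈0

module FieldProperties {c ℓ} (F : Field c ℓ) where

  open Field F
  open import Algebra.Properties.Ring ring using (-0#≈0#)
  open import Relation.Binary.Reasoning.Setoid setoid

  x*y≈0⇒y≈0 : ∀ {x y} → ¬ x ≈ 0# → x * y ≈ 0# → y ≈ 0#
  x*y≈0⇒y≈0 {x} {y} x≉0 xy≈0 = begin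
    y              ≈⟨ *-identityˡ y ⟨
    1# * y         ≈⟨ *-congʳ (trans (*-comm (x ⁻¹) x) (⁻¹-inverseʳ x x≉0)) ⟨
    (x ⁻¹ * x) * y ≈⟨ *-assoc (x ⁻¹) x y ⟩
    x ⁻¹ * (x * y) ≈⟨ *-congˡ xy≈0 ⟩
    x ⁻¹ * 0#      ≈⟨ zeroʳ (x ⁻¹) ⟩
    0#             ∎

  x*y≉0 : ∀ {x y} → ¬ x ≈ 0# → ¬ y ≈ 0# → ¬ x * y ≈ 0#
  x*y≉0 x≉0 y≉0 xy≈0 = y≉0 (x*y≈0⇒y≈0 x≉0 xy≈0)

  x*y/y≈x : ∀ x {y} → ¬ y ≈ 0# → (x * y) / y ≈ x
  x*y/y≈x x {y} y≉0 = begin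
    (x * y) * y ⁻¹ ≈⟨ *-assoc x y (y ⁻¹) ⟩
    x * (y * y ⁻¹) ≈⟨ *-congˡ (⁻¹-inverseʳ y y≉0) ⟩
    x * 1#         ≈⟨ *-identityʳ x ⟩
    x              ∎

  x/y*y≈x : ∀ x {y} → ¬ y ≈ 0# → (x / y) * y ≈ x
  x/y*y≈x x {y} y≉0 = begin
    (x * y ⁻¹) * y ≈⟨ *-assoc x (y ⁻¹) y ⟩
    x * (y ⁻¹ * y) ≈⟨ *-congˡ (trans (*-comm (y ⁻¹) y) (⁻¹-inverseʳ y y≉0)) ⟩
    x * 1#         ≈⟨ *-identityʳ x ⟩
    x              ∎

  x≈0⇒-x≈0 : ∀ {x} → x ≈ 0# → - x ≈ 0#
  x≈0⇒-x≈0 x≈0 = trans (-‿cong x≈0) -0#≈0#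

module IrreducibleCubic {c ℓ} (F : Field c ℓ) where

  open Field F
  open FieldProperties F
  open PolynomialProperties commutativeRing
  open CubicIdentities commutativeRing using (cubicValue)
  open IntegerRingSolver commutativeRing using (solve; _:=_; _:+_; _:*_; _:-_; :-_; con)
  open import Relation.Binary.Reasoning.Setoid setoid

  cubic-factorisation : ∀ {a} r → cubicValue a r ≈ 0# → ∀ k →
    coeff (cubic F a) k ≈ mulCoeff commutativeRing (linear (- r)) (quadratic r (r * r - 3#)) k
  cubic-factorisation {a} r r-root 0 = begin
    - a
      ≈⟨ solve 2 (λ a r → :- a := (:- r) :* (r :* r :- con (+ 3)) :+ (r :* r :* r :- con (+ 3) :* r :- a))
               refl a r ⟩
    (- r) * (r * r - 3#) + cubicValue a r  ≈⟨ +-congˡ r-root ⟩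
    (- r) * (r * r - 3#) + 0#              ≈⟨ +-identityʳ _ ⟩
    (- r) * (r * r - 3#)                   ∎
  cubic-factorisation r _ 1 =
    solve 1 (λ r → :- con (+ 3) := (:- r) :* r :+ con (+ 1) :* (r :* r :- con (+ 3))) refl r
  cubic-factorisation r _ 2 =
    solve 1 (λ r → con (+ 0) := ((:- r) :* con (+ 1) :+ con (+ 1) :* r) :+ con (+ 0) :* (r :* r :- con (+ 3)))
            refl r
  cubic-factorisation r _ 3 =
    solve 1 (λ r → con (+ 1) := (((:- r) :* con (+ 0) :+ con (+ 1) :* con (+ 1)) :+ con (+ 0) :* r)
                                :+ con (+ 0) :* (r :* r :- con (+ 3))) refl r
  cubic-factorisation r _ k@(suc (suc (suc (suc _)))) = sym (sumTo-zero _ k factors-vanish)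
    where
      factors-vanish : ∀ i → i ≤ k → linearCoeff (- r) i * quadraticCoeff r (r * r - 3#) (k ℕ.∸ i) ≈ 0#
      factors-vanish 0             _ = zeroʳ _
      factors-vanish 1             _ = zeroʳ _
      factors-vanish (suc (suc i)) _ = zeroˡ _

  module _ {a} (irr : Irreducible commutativeRing (cubic F a)) where

    no-root : ∀ r → ¬ cubicValue a r ≈ 0#
    no-root r r-root = [ monic⇒¬unit 1≉0 g 0 (vanish g) refl , monic⇒¬unit 1≉0 h 1 (vanish h) refl ]′
                         (proj₂ (proj₂ irr) g h (cubic-factorisation r r-root))
      where
        g = linear (- r)
        h = quadratic r (r * r - 3#)

    a≉0 : ¬ a ≈ 0#
    a≉0 a≈0 = no-root 0# (trans (solve 1 (λ a →
      con (+ 0) :* con (+ 0) :* con (+ 0) :- con (+ 3) :* con (+ 0) :- a := :- a) refl a)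
      (x≈0⇒-x≈0 a≈0))

    a²-4≉0 : ¬ a ^ 2 - (2# + 2#) ≈ 0#
    a²-4≉0 a²-4≈0 = a+2≉0 (x*y≈0⇒y≈0 a-2≉0 (trans (solve 1 (λ a →
        (a :- con (+ 2)) :* (a :+ con (+ 2)) := a :* (a :* con (+ 1)) :- (con (+ 2) :+ con (+ 2))) refl a) a²-4≈0))
      where
        a-2≉0 : ¬ a - 2# ≈ 0#
        a-2≉0 a-2≈0 = no-root (- 1#) (trans (solve 1 (λ a →
          (:- con (+ 1)) :* (:- con (+ 1)) :* (:- con (+ 1)) :- con (+ 3) :* (:- con (+ 1)) :- a
          := :- (a :- con (+ 2))) refl a)
          (x≈0⇒-x≈0 a-2≈0))
        a+2≉0 : ¬ a + 2# ≈ 0#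
        a+2≉0 a+2≈0 = no-root 1# (trans (solve 1 (λ a →
          con (+ 1) :* con (+ 1) :* con (+ 1) :- con (+ 3) :* con (+ 1) :- a := :- (a :+ con (+ 2))) refl a)
          (x≈0⇒-x≈0 a+2≈0))

module FieldHomomorphism {c ℓ c′ ℓ′} (F : Field c ℓ) (K : Field c′ ℓ′)
                         (ι : Field.Carrier F → Field.Carrier K) (hom : IsFieldHom F K ι) where

  private
    module F = Field F
  open Field K
  open RingMorphisms.IsRingHomomorphism hom
  open FieldProperties F using (x/y*y≈x)
  open CubicIdentities commutativeRing using (cubicValue)
  open IntegerRingSolver commutativeRing using (solve; _:=_; _:+_; _:*_; _:-_; :-_; con)
  open import Relation.Binary.Reasoning.Setoid setoid

  ι-nonzero : ∀ {x} → ¬ x F.≈ F.0# → ¬ ι x ≈ 0#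
  ι-nonzero {x} x≉0 ιx≈0 = 1≉0 (begin
    1#                ≈⟨ 1#-homo ⟨
    ι F.1#            ≈⟨ ⟦⟧-cong (F.⁻¹-inverseʳ x x≉0) ⟨
    ι (x F.* x F.⁻¹)  ≈⟨ *-homo x (x F.⁻¹) ⟩
    ι x * ι (x F.⁻¹)  ≈⟨ *-congʳ ιx≈0 ⟩
    0# * ι (x F.⁻¹)   ≈⟨ zeroˡ _ ⟩
    0#                ∎)

  ι-2# : ι F.2# ≈ 2#
  ι-2# = trans (+-homo F.1# F.1#) (+-cong 1#-homo 1#-homo)

  ι-3# : ι F.3# ≈ 3#
  ι-3# = trans (+-homo F.2# F.1#) (+-cong ι-2# 1#-homo)

  ι-[x²-c] : ∀ x c → ι (x F.^ 2 F.- c) ≈ ι x * ι x - ι c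
  ι-[x²-c] x c = begin
    ι (x F.^ 2 F.- c)            ≈⟨ +-homo (x F.^ 2) (F.- c) ⟩
    ι (x F.^ 2) + ι (F.- c)      ≈⟨ +-cong (*-homo x (x F.* F.1#)) (-‿homo c) ⟩
    ι x * ι (x F.* F.1#) - ι c   ≈⟨ +-congʳ (*-congˡ (trans (*-homo x F.1#) (*-congˡ 1#-homo))) ⟩
    ι x * (ι x * 1#) - ι c       ≈⟨ +-congʳ (*-congˡ (*-identityʳ (ι x))) ⟩
    ι x * ι x - ι c              ∎

  ι-[x²-4] : ∀ x → ι (x F.^ 2 F.- (F.2# F.+ F.2#)) ≈ ι x * ι x - (2# + 2#)
  ι-[x²-4] x = trans (ι-[x²-c] x _) (+-congˡ (-‿cong (trans (+-homo F.2# F.2#) (+-cong ι-2# ι-2#))))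

  ι-[x²-4]-nonzero : ∀ {x} → ¬ x F.^ 2 F.- (F.2# F.+ F.2#) F.≈ F.0# → ¬ ι x * ι x - (2# + 2#) ≈ 0#
  ι-[x²-4]-nonzero {x} x²-4≉0 ιx²-4≈0 = ι-nonzero x²-4≉0 (trans (ι-[x²-4] x) ιx²-4≈0)

  ι-[x²-4]*quotient : ∀ {x} → ¬ x F.^ 2 F.- (F.2# F.+ F.2#) F.≈ F.0# →
    (ι x * ι x - (2# + 2#)) * ι ((x F.^ 2 F.- F.1#) F./ (x F.^ 2 F.- (F.2# F.+ F.2#))) ≈ ι x * ι x - 1#
  ι-[x²-4]*quotient {x} x²-4≉0 = begin
    (ι x * ι x - (2# + 2#)) * ι (x²-1 F./ x²-4) ≈⟨ *-comm _ _ ⟩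
    ι (x²-1 F./ x²-4) * (ι x * ι x - (2# + 2#)) ≈⟨ *-congˡ (ι-[x²-4] x) ⟨
    ι (x²-1 F./ x²-4) * ι x²-4                  ≈⟨ *-homo _ _ ⟨
    ι ((x²-1 F./ x²-4) F.* x²-4)                ≈⟨ ⟦⟧-cong (x/y*y≈x x²-1 x²-4≉0) ⟩
    ι x²-1                                      ≈⟨ trans (ι-[x²-c] x F.1#) (+-congˡ (-‿cong 1#-homo)) ⟩
    ι x * ι x - 1#                              ∎
    where
      x²-1 = x F.^ 2 F.- F.1#
      x²-4 = x F.^ 2 F.- (F.2# F.+ F.2#)

  evalVia-cubic : ∀ a y → evalVia F K ι (cubic F a) y ≈ cubicValue (ι a) y
  evalVia-cubic a y = begin
    ((ι (F.- a) * 1# + ι (F.- F.3#) * (y * 1#)) + ι F.0# * (y * (y * 1#))) + ι F.1# * (y * (y * (y * 1#)))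
      ≈⟨ +-cong (+-cong (+-cong (*-congʳ (-‿homo a)) (*-congʳ (trans (-‿homo F.3#) (-‿cong ι-3#))))
                        (*-congʳ 0#-homo))
                (*-congʳ 1#-homo) ⟩
    ((- ι a * 1# + - 3# * (y * 1#)) + 0# * (y * (y * 1#))) + 1# * (y * (y * (y * 1#)))
      ≈⟨ solve 2 (λ A y →
           ((:- A :* con (+ 1) :+ :- con (+ 3) :* (y :* con (+ 1))) :+ con (+ 0) :* (y :* (y :* con (+ 1))))
             :+ con (+ 1) :* (y :* (y :* (y :* con (+ 1))))
           := y :* y :* y :- con (+ 3) :* y :- A) refl (ι a) y ⟩
    cubicValue (ι a) y
      ∎

module TwoRoots {c ℓ} (K : Field c ℓ) where

  open Field K
  open FieldProperties K
  open CubicIdentities commutativeRing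
    using (cubicValue; numerator; denominator; cubicValue-difference; denominator-certificate;
           f-quadratic-certificate; denominator+2*numerator; z-formula-certificate)
  open IntegerRingSolver commutativeRing using (solve; _:=_; _:+_; _:*_; _:-_; :-_; con)
  open import Relation.Binary.Reasoning.Setoid setoid
  open import Algebra.Properties.Ring ring using (x∙y⁻¹≈ε⇒x≈y)

  fraction-quadratic : ∀ N {D} k → ¬ D ≈ 0# →
                       (D * D) * ((N / D) ^ 2 + N / D + k) ≈ N * N + N * D + k * (D * D)
  fraction-quadratic N {D} k D≉0 = begin
    (D * D) * ((N / D) ^ 2 + N / D + k)
      ≈⟨ solve 4 (λ N D d k →
           (D :* D) :* ((N :* d) :* ((N :* d) :* con (+ 1)) :+ N :* d :+ k)
           := (N :* N) :* ((D :* d) :* (D :* d)) :+ (N :* D) :* (D :* d) :+ k :* (D :* D)) refl N D (D ⁻¹) k ⟩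
    (N * N) * ((D / D) * (D / D)) + (N * D) * (D / D) + k * (D * D)
      ≈⟨ +-congʳ (+-cong (*-congˡ (trans (*-cong D/D≈1 D/D≈1) (*-identityˡ 1#))) (*-congˡ D/D≈1)) ⟩
    (N * N) * 1# + (N * D) * 1# + k * (D * D)
      ≈⟨ +-congʳ (+-cong (*-identityʳ (N * N)) (*-identityʳ (N * D))) ⟩
    N * N + N * D + k * (D * D)
      ∎
    where D/D≈1 = ⁻¹-inverseʳ D D≉0

  module _ {A y : Carrier} (y-root : cubicValue A y ≈ 0#) where

    denominator≉0 : ¬ A * A - (2# + 2#) ≈ 0# → ¬ denominator A y ≈ 0#
    denominator≉0 A²-4≉0 D≈0 = A²-4≉0 (begin
      A * A - (2# + 2#)
        ≈⟨ denominator-certificate A y ⟩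
      (y * y - 1#) * denominator A y + (2# * y - A) * cubicValue A y
        ≈⟨ +-cong (*-congˡ D≈0) (*-congˡ y-root) ⟩
      (y * y - 1#) * 0# + (2# * y - A) * 0#
        ≈⟨ +-cong (zeroʳ _) (zeroʳ _) ⟩
      0# + 0#
        ≈⟨ +-identityʳ 0# ⟩
      0#
        ∎)

    module _ {z : Carrier} where

      private
        N = numerator A y z
        D = denominator A y
        f = N / D

      root-of-quotient : cubicValue A z ≈ 0# → ¬ z ≈ y → z * z + z * y + y * y - 3# ≈ 0#
      root-of-quotient z-root z≉y = x*y≈0⇒y≈0 z-y≉0 (begin
        (z - y) * (z * z + z * y + y * y - 3#) ≈⟨ cubicValue-difference A y z ⟨
        cubicValue A z - cubicValue A y        ≈⟨ +-cong z-root (-‿cong y-root) ⟩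
        0# - 0#                                ≈⟨ -‿inverseʳ 0# ⟩
        0#                                     ∎)
        where
          z-y≉0 : ¬ z - y ≈ 0#
          z-y≉0 z-y≈0 = z≉y (x∙y⁻¹≈ε⇒x≈y z y z-y≈0)

      f-quadratic : ∀ {k} → ¬ A * A - (2# + 2#) ≈ 0# → (A * A - (2# + 2#)) * k ≈ A * A - 1# →
                    cubicValue A z ≈ 0# → ¬ z ≈ y → (f ^ 2) + f + k ≈ 0#
      f-quadratic {k} A²-4≉0 k-def z-root z≉y =
        x*y≈0⇒y≈0 (x*y≉0 D≉0 D≉0) (x*y≈0⇒y≈0 A²-4≉0 (begin
          Q * ((D * D) * ((f ^ 2) + f + k))
            ≈⟨ *-congˡ (fraction-quadratic N k D≉0) ⟩
          Q * (N * N + N * D + k * (D * D))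
            ≈⟨ solve 4 (λ Q N D k →
                 Q :* (N :* N :+ N :* D :+ k :* (D :* D)) := Q :* (N :* N :+ N :* D) :+ (Q :* k) :* (D :* D))
                 refl Q N D k ⟩
          Q * (N * N + N * D) + (Q * k) * (D * D)
            ≈⟨ +-congˡ (*-congʳ k-def) ⟩
          Q * (N * N + N * D) + (A * A - 1#) * (D * D)
            ≈⟨ f-quadratic-certificate A y z ⟩
          (A * A) * (Q * (z * z + z * y + y * y - 3#) + 3# * (y - A) * cubicValue A y)
            ≈⟨ *-congˡ (+-cong (*-congˡ (root-of-quotient z-root z≉y)) (*-congˡ y-root)) ⟩
          (A * A) * (Q * 0# + 3# * (y - A) * 0#)
            ≈⟨ *-congˡ (trans (+-cong (zeroʳ Q) (zeroʳ _)) (+-identityʳ 0#)) ⟩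
          (A * A) * 0#
            ≈⟨ zeroʳ (A * A) ⟩
          0#
            ∎))
        where
          Q = A * A - (2# + 2#)
          D≉0 = denominator≉0 A²-4≉0

      z-formula : ¬ A ≈ 0# → ¬ A * A - (2# + 2#) ≈ 0# →
                  z ≈ (- ((1# + 2# * f) / A)) * (y ^ 2) + f * y + (2# * (1# + 2# * f)) / A
      z-formula A≉0 A²-4≉0 = sym (begin
        (- ((1# + 2# * f) / A)) * (y ^ 2) + f * y + (2# * (1# + 2# * f)) / A
          ≈⟨ solve 3 (λ f e y →
               (:- ((con (+ 1) :+ con (+ 2) :* f) :* e)) :* (y :* (y :* con (+ 1))) :+ f :* y
                 :+ (con (+ 2) :* (con (+ 1) :+ con (+ 2) :* f)) :* e
               := ((con (+ 1) :+ con (+ 2) :* f) :* e) :* (con (+ 2) :- y :* y) :+ f :* y) refl f (A ⁻¹) y ⟩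
        ((1# + 2# * f) / A) * (2# - y * y) + f * y
          ≈⟨ +-congʳ (*-congʳ [1+2f]/A≈[y+2z]/D) ⟩
        ((y + 2# * z) / D) * (2# - y * y) + (N / D) * y
          ≈⟨ solve 4 (λ w N d y →
               (w :* d) :* (con (+ 2) :- y :* y) :+ (N :* d) :* y
               := (w :* (con (+ 2) :- y :* y) :+ N :* y) :* d) refl (y + 2# * z) N (D ⁻¹) y ⟩
        ((y + 2# * z) * (2# - y * y) + N * y) / D
          ≈⟨ *-congʳ (z-formula-certificate A y z) ⟩
        (z * D) / D
          ≈⟨ x*y/y≈x z D≉0 ⟩
        z ∎)
        where
          D≉0 = denominator≉0 A²-4≉0

          1+2f≈D+2N/D : 1# + 2# * f ≈ (D + 2# * N) / D
          1+2f≈D+2N/D = begin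
            1# + 2# * (N * D ⁻¹)       ≈⟨ +-congʳ (⁻¹-inverseʳ D D≉0) ⟨
            D * D ⁻¹ + 2# * (N * D ⁻¹) ≈⟨ solve 3 (λ D N d → D :* d :+ con (+ 2) :* (N :* d)
                                                         := (D :+ con (+ 2) :* N) :* d) refl D N (D ⁻¹) ⟩
            (D + 2# * N) * D ⁻¹        ∎

          [1+2f]/A≈[y+2z]/D : (1# + 2# * f) / A ≈ (y + 2# * z) / D
          [1+2f]/A≈[y+2z]/D = begin
            (1# + 2# * f) / A             ≈⟨ *-congʳ 1+2f≈D+2N/D ⟩
            ((D + 2# * N) / D) / A        ≈⟨ *-congʳ (*-congʳ (denominator+2*numerator A y z)) ⟩
            ((A * (y + 2# * z)) / D) / A  ≈⟨ *-congʳ (solve 3 (λ A w d → (A :* w) :* d := (w :* d) :* A)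
                                                             refl A (y + 2# * z) (D ⁻¹)) ⟩
            (((y + 2# * z) / D) * A) / A  ≈⟨ x*y/y≈x ((y + 2# * z) / D) A≉0 ⟩
            (y + 2# * z) / D              ∎

  two-roots-relation : ∀ {A k y z} → ¬ A ≈ 0# → ¬ A * A - (2# + 2#) ≈ 0# →
                       (A * A - (2# + 2#)) * k ≈ A * A - 1# →
                       cubicValue A y ≈ 0# → cubicValue A z ≈ 0# → ¬ z ≈ y →
                       ∃ λ f → ((f ^ 2) + f + k ≈ 0#) ×
                               (z ≈ (- ((1# + 2# * f) / A)) * (y ^ 2) + f * y + (2# * (1# + 2# * f)) / A)
  two-roots-relation {A} {k} {y} {z} A≉0 A²-4≉0 k-def y-root z-root z≉y =
    numerator A y z / denominator A y ,
    f-quadratic y-root A²-4≉0 k-def z-root z≉y ,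
    z-formula y-root A≉0 A²-4≉0

mainTheorem5 : ∀ {c ℓ c′ ℓ′ : Level} (F : Field c ℓ) (K : Field c′ ℓ′)
                 (ι : Field.Carrier F → Field.Carrier K) → IsAlgebraicClosure F K ι →
                 ¬ (Field._≈_ F (Field.3# F) (Field.0# F)) →
                 (a : Field.Carrier F) → Irreducible (Field.commutativeRing F) (cubic F a) →
                 (y₁ y₂ : Field.Carrier K) →
                 Field._≈_ K (evalVia F K ι (cubic F a) y₁) (Field.0# K) →
                 Field._≈_ K (evalVia F K ι (cubic F a) y₂) (Field.0# K) →
                 ¬ (Field._≈_ K y₁ y₂) →
                 let open Field K
                     A = ι a
                     cF = Field._/_ F (Field._-_ F (Field._^_ F a 2) (Field.1# F))
                                      (Field._-_ F (Field._^_ F a 2) (Field._+_ F (Field.2# F) (Field.2# F)))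
                 in ∃ λ (f : Carrier) →
                      ((f ^ 2) + f + ι cF ≈ 0#) ×
                      (y₁ ≈ (- ((1# + 2# * f) / A)) * (y₂ ^ 2) + f * y₂ + (2# * (1# + 2# * f)) / A)
mainTheorem5 F K ι isAC _ a irr y₁ y₂ y₁-root y₂-root y₁≉y₂ =
  two-roots-relation (ι-nonzero (a≉0 irr)) (ι-[x²-4]-nonzero (a²-4≉0 irr)) (ι-[x²-4]*quotient (a²-4≉0 irr))
                     (trans (sym (evalVia-cubic a y₂)) y₂-root)
                     (trans (sym (evalVia-cubic a y₁)) y₁-root)
                     y₁≉y₂
  where
    open Field K using (trans; sym)
    open FieldHomomorphism F K ι (IsAlgebraicClosure.hom isAC)
    open IrreducibleCubic F using (a≉0; a²-4≉0)
    open TwoRoots K using (two-roots-relation)
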